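{- Let $h\ge 2$ be an integer, let $n=3h-1$, and let $V$ be an $n$-element set. Let $\mathcal K\subset \binom{V}{h}$ be a family of $h$-subsets of $V$ satisfying: (K1) for every $(h-1)$-subset $A\subset V$, at least one of the $2h$ sets $A\cup\{v\}$, $v\in V\setminus A$, does not belong to $\mathcal K$; (K2) for every $2h$-subset $X\subset V$, there is an $h$-set $R\subset X$ with $R\in\mathcal K$ and $X\setminus R\in\mathcal K$; (K3) for every $h$-subset $Y\subset V$, there is a set $U\subset V\setminus Y$ with $|U|=h-1$ such that $U\cup\{y\}\in\mathcal K$ for every $y\in Y$. Let $\mathcal G=\binom{V}{h}\setminus\mathcal K$ and let $\mathcal H$ be the $(2h-1)$-uniform hypergraph on $V$ with edge set $\{V\setminus B: B\in\mathcal G\}$. Then $\mathcal H$ has no polychromatic $3$-coloring, but all of its $h$-heavy restricted subhypergraphs are $2$-colorable.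
   Context: $\binom{V}{h}$ denotes the family of all $h$-element subsets of $V$. A hypergraph is $h$-heavy if all its edges have size at least $h$. For $X\subset V$, the trace of a hypergraph $\mathcal H$ on $X$ is the hypergraph on $X$ with edges $\{e\cap X: e\in E(\mathcal H)\}$; a restricted subhypergraph is a subhypergraph of a trace. A coloring with colors $1,\dots,k$ is polychromatic if every edge contains all $k$ colors; $2$-colorable means admitting a red–blue coloring with no monochromatic edge. -}

module Defs where

open import Data.Nat using (ℕ; suc; _*_; _∸_; _≤_)
open import Data.Bool using (Bool; true; false)
open import Data.Fin using (Fin)
open import Data.Fin.Subset using (Subset; _∈_; _∉_; _⊆_; ∁; _∩_; _∪_; _─_; ⁅_⁆; ∣_∣)
open import Data.Product using (Σ; ∃; ∃-syntax; _×_; _,_)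
open import Relation.Binary.PropositionalEquality using (_≡_)
open import Relation.Nullary using (¬_)

Family : ℕ → Set
Family n = Subset n → Bool

FamilyOfHSets : ∀ {n} → ℕ → Family n → Set
FamilyOfHSets h K = ∀ S → K S ≡ true → ∣ S ∣ ≡ h

K1 : ∀ {n} → ℕ → Family n → Set
K1 {n} h K = ∀ (A : Subset n) → ∣ A ∣ ≡ h ∸ 1 →
  ∃[ v ] (v ∉ A × K (A ∪ ⁅ v ⁆) ≡ false)

K2 : ∀ {n} → ℕ → Family n → Set
K2 {n} h K = ∀ (X : Subset n) → ∣ X ∣ ≡ 2 * h →
  ∃[ R ] (R ⊆ X × ∣ R ∣ ≡ h × K R ≡ true × K (X ─ R) ≡ true)

K3 : ∀ {n} → ℕ → Family n → Set
K3 {n} h K = ∀ (Y : Subset n) → ∣ Y ∣ ≡ h →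
  ∃[ U ] (U ⊆ ∁ Y × ∣ U ∣ ≡ h ∸ 1 × (∀ y → y ∈ Y → K (U ∪ ⁅ y ⁆) ≡ true))

InG : ∀ {n} → ℕ → Family n → Subset n → Set
InG h K B = ∣ B ∣ ≡ h × K B ≡ false

EdgeH : ∀ {n} → ℕ → Family n → Subset n → Set
EdgeH h K e = ∃[ B ] (InG h K B × e ≡ ∁ B)

Polychromatic3 : ∀ {n} → (Subset n → Set) → (Fin n → Fin 3) → Set
Polychromatic3 E c = ∀ e → E e → ∀ (i : Fin 3) → ∃[ v ] (v ∈ e × c v ≡ i)

ProperTwoColoring : ∀ {n} → (Subset n → Set) → (Fin n → Bool) → Set
ProperTwoColoring F c = ∀ f → F f →
  ∃[ u ] ∃[ w ] (u ∈ f × w ∈ f × c u ≡ true × c w ≡ false)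

HeavyRestrictedEdges : ∀ {n} → ℕ → (Subset n → Set) → Subset n → (Subset n → Set) → Set
HeavyRestrictedEdges h E X F =
  ∀ f → F f → (∃[ e ] (E e × f ≡ e ∩ X)) × h ≤ ∣ f ∣

-- A 3-colouring of the 3h − 1 vertices has a colour class C of at most h − 1 vertices.
-- Enlarge C to an (h − 1)-set A; by (K1) some A ∪ {v} lies in 𝒢, so its complement is an
-- edge of ℋ missing the colour of C: ℋ has no polychromatic 3-colouring.
--
-- For a trace on X, the edges are the sets X ∖ B (B ∈ 𝒢) with at least h elements, and a
-- red set R of X avoided by X ∖ B lies inside B. We colour a set R red and the rest blue:
--  * if |X| ≥ 2h, take R from (K2) applied to a 2h-subset X′ of X: an edge missing R or
--    X′ ∖ R would force that h-set of 𝒦 to be the h-set B of 𝒢;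
--  * if |X| = 2h − 1, take R = U from (K3) applied to Y = V ∖ X: an edge missing U has
--    U ⊆ B, and B either contains some U ∪ {y} ∈ 𝒦 (y ∉ X), or lies in X, leaving at most
--    h − 1 vertices for X ∖ B;
--  * if |X| ≤ 2h − 2, any R ⊆ X of min(h − 1, |X|) elements works by counting alone.
module Submission where

open import Data.Nat using (ℕ; zero; suc; _+_; _*_; _∸_; _≤_; _<_; z≤n; s≤s; _≤?_; z<s; NonZero)
open import Data.Nat.Properties hiding (_≟_)
open import Data.Bool using (true; false)
open import Data.Fin using (Fin; zero; suc; _≟_)
open import Data.Fin.Subset
open import Data.Fin.Subset.Properties
open import Data.Vec using ([]; _∷_; lookup; here; there)
open import Data.Vec.Properties using ([]=⇒lookup; lookup⇒[]=)
open import Data.Product using (∃-syntax; _×_; _,_; proj₁; proj₂)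
open import Data.Sum using (inj₁; inj₂)
open import Data.Empty using (⊥-elim)
open import Relation.Nullary using (¬_; yes; no)
open import Relation.Nullary.Decidable using (⌊_⌋)
open import Relation.Binary.PropositionalEquality
open import Defs

private
  variable
    n : ℕ
    p q r : Subset n

p⊆q∧∣q∣≤∣p∣⇒p≡q : p ⊆ q → ∣ q ∣ ≤ ∣ p ∣ → p ≡ q
p⊆q∧∣q∣≤∣p∣⇒p≡q {p = p} {q} p⊆q ∣q∣≤∣p∣ = ⊆-antisym p⊆q q⊆p
  where
  q⊆p : q ⊆ p
  q⊆p {x} x∈q with x ∈? p
  ... | yes x∈p = x∈p
  ... | no x∉p = ⊥-elim (<⇒≱ (p⊂q⇒∣p∣<∣q∣ (p⊆q , x , x∈q , x∉p)) ∣q∣≤∣p∣)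

x∈p─q⇒x∉q : ∀ {x : Fin n} (p q : Subset n) → x ∈ p ─ q → x ∉ q
x∈p─q⇒x∉q (_ ∷ p) (inside ∷ q) (there x∈p─q) (there x∈q) = x∈p─q⇒x∉q p q x∈p─q x∈q
x∈p─q⇒x∉q (_ ∷ p) (outside ∷ q) (there x∈p─q) (there x∈q) = x∈p─q⇒x∉q p q x∈p─q x∈q

Empty[p∩∁q]⇒p⊆q : Empty (p ∩ ∁ q) → p ⊆ q
Empty[p∩∁q]⇒p⊆q {p = p} empty {x} x∈p =
  x∉∁p⇒x∈p (λ x∈∁q → empty (x , x∈p∩q⁺ (x∈p , x∈∁q)))

∣p∣≡∣p∩q∣+∣p─q∣ : ∀ (p q : Subset n) → ∣ p ∣ ≡ ∣ p ∩ q ∣ + ∣ p ─ q ∣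
∣p∣≡∣p∩q∣+∣p─q∣ []            []            = refl
∣p∣≡∣p∩q∣+∣p─q∣ (inside ∷ p)  (inside ∷ q)  = cong suc (∣p∣≡∣p∩q∣+∣p─q∣ p q)
∣p∣≡∣p∩q∣+∣p─q∣ (inside ∷ p)  (outside ∷ q) =
  trans (cong suc (∣p∣≡∣p∩q∣+∣p─q∣ p q)) (sym (+-suc _ _))
∣p∣≡∣p∩q∣+∣p─q∣ (outside ∷ p) (inside ∷ q)  = ∣p∣≡∣p∩q∣+∣p─q∣ p q
∣p∣≡∣p∩q∣+∣p─q∣ (outside ∷ p) (outside ∷ q) = ∣p∣≡∣p∩q∣+∣p─q∣ p q

Empty[p∩q]⇒∣p∣+∣q∣≤∣r∣ : Empty (p ∩ q) → p ⊆ r → q ⊆ r → ∣ p ∣ + ∣ q ∣ ≤ ∣ r ∣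
Empty[p∩q]⇒∣p∣+∣q∣≤∣r∣ {p = p} {q} {r} empty p⊆r q⊆r = begin
  ∣ p ∣ + ∣ q ∣         ≤⟨ +-mono-≤ (p⊆q⇒∣p∣≤∣q∣ p⊆r∩p) (p⊆q⇒∣p∣≤∣q∣ q⊆r─p) ⟩
  ∣ r ∩ p ∣ + ∣ r ─ p ∣ ≡⟨ ∣p∣≡∣p∩q∣+∣p─q∣ r p ⟨
  ∣ r ∣                 ∎
  where
  open ≤-Reasoning
  p⊆r∩p : p ⊆ r ∩ p
  p⊆r∩p x∈p = x∈p∩q⁺ (p⊆r x∈p , x∈p)
  q⊆r─p : q ⊆ r ─ p
  q⊆r─p {x} x∈q = x∈p∧x∉q⇒x∈p─q (q⊆r x∈q) (λ x∈p → empty (x , x∈p∩q⁺ (x∈p , x∈q)))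

∣q∣<∣p∣⇒¬Empty[p∩∁q] : ∣ q ∣ < ∣ p ∣ → ¬ Empty (p ∩ ∁ q)
∣q∣<∣p∣⇒¬Empty[p∩∁q] ∣q∣<∣p∣ empty = <⇒≱ ∣q∣<∣p∣ (p⊆q⇒∣p∣≤∣q∣ (Empty[p∩∁q]⇒p⊆q empty))

x∉p⇒∣p∪⁅x⁆∣≡1+∣p∣ : ∀ (p : Subset n) (x : Fin n) → x ∉ p → ∣ p ∪ ⁅ x ⁆ ∣ ≡ suc ∣ p ∣
x∉p⇒∣p∪⁅x⁆∣≡1+∣p∣ (inside ∷ p)  zero    x∉p = ⊥-elim (x∉p here)
x∉p⇒∣p∪⁅x⁆∣≡1+∣p∣ (outside ∷ p) zero    x∉p = cong (λ q → suc ∣ q ∣) (∪-identityʳ p)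
x∉p⇒∣p∪⁅x⁆∣≡1+∣p∣ (inside ∷ p)  (suc x) x∉p =
  cong suc (x∉p⇒∣p∪⁅x⁆∣≡1+∣p∣ p x (λ x∈p → x∉p (there x∈p)))
x∉p⇒∣p∪⁅x⁆∣≡1+∣p∣ (outside ∷ p) (suc x) x∉p =
  x∉p⇒∣p∪⁅x⁆∣≡1+∣p∣ p x (λ x∈p → x∉p (there x∈p))

∃-⊆-⊆-∣∣≡ : ∀ (p q : Subset n) → p ⊆ q → (k : ℕ) → ∣ p ∣ ≤ k → k ≤ ∣ q ∣ →
  ∃[ r ] (p ⊆ r × r ⊆ q × ∣ r ∣ ≡ k)
∃-⊆-⊆-∣∣≡ [] [] _ zero _ _ = [] , (λ ()) , (λ ()) , refl
∃-⊆-⊆-∣∣≡ (inside ∷ p) (outside ∷ q) p⊆q _ _ _ with () ← p⊆q here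
∃-⊆-⊆-∣∣≡ (inside ∷ p) (inside ∷ q) p⊆q (suc k) (s≤s ∣p∣≤k) (s≤s k≤∣q∣)
  with r , p⊆r , r⊆q , ∣r∣≡k ← ∃-⊆-⊆-∣∣≡ p q (drop-∷-⊆ p⊆q) k ∣p∣≤k k≤∣q∣ =
  inside ∷ r , s⊆s p⊆r , s⊆s r⊆q , cong suc ∣r∣≡k
∃-⊆-⊆-∣∣≡ (outside ∷ p) (outside ∷ q) p⊆q k ∣p∣≤k k≤∣q∣
  with r , p⊆r , r⊆q , ∣r∣≡k ← ∃-⊆-⊆-∣∣≡ p q (drop-∷-⊆ p⊆q) k ∣p∣≤k k≤∣q∣ =
  outside ∷ r , s⊆s p⊆r , s⊆s r⊆q , ∣r∣≡k
∃-⊆-⊆-∣∣≡ (outside ∷ p) (inside ∷ q) p⊆q k ∣p∣≤k k≤1+∣q∣ with k ≤? ∣ q ∣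
... | yes k≤∣q∣ with r , p⊆r , r⊆q , ∣r∣≡k ← ∃-⊆-⊆-∣∣≡ p q (drop-∷-⊆ p⊆q) k ∣p∣≤k k≤∣q∣ =
  outside ∷ r , s⊆s p⊆r , out⊆ r⊆q , ∣r∣≡k
... | no k≰∣q∣ =
  inside ∷ q , out⊆ (drop-∷-⊆ p⊆q) , ⊆-refl , ≤-antisym (≰⇒> k≰∣q∣) k≤1+∣q∣

∃-⊆-∣∣≡ : ∀ (q : Subset n) k → k ≤ ∣ q ∣ → ∃[ r ] (r ⊆ q × ∣ r ∣ ≡ k)
∃-⊆-∣∣≡ {n} q k k≤∣q∣
  with r , _ , r⊆q , ∣r∣≡k ← ∃-⊆-⊆-∣∣≡ ⊥ q (⊆-min q) k (subst (_≤ k) (sym (∣⊥∣≡0 n)) z≤n) k≤∣q∣ =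
  r , r⊆q , ∣r∣≡k

colourClass : ∀ {k} → (Fin n → Fin k) → Fin k → Subset n
colourClass {zero}  c i = []
colourClass {suc n} c i = ⌊ c zero ≟ i ⌋ ∷ colourClass (λ v → c (suc v)) i

x∈colourClass[c[x]] : ∀ {k} (c : Fin n → Fin k) (x : Fin n) → x ∈ colourClass c (c x)
x∈colourClass[c[x]] c zero with c zero ≟ c zero
... | yes _ = here
... | no c₀≢c₀ = ⊥-elim (c₀≢c₀ refl)
x∈colourClass[c[x]] c (suc x) = there (x∈colourClass[c[x]] (λ v → c (suc v)) x)

∑∣colourClass∣≡n : (c : Fin n → Fin 3) →
  ∣ colourClass c zero ∣ + ∣ colourClass c (suc zero) ∣ + ∣ colourClass c (suc (suc zero)) ∣ ≡ n
∑∣colourClass∣≡n {zero} c = refl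
∑∣colourClass∣≡n {suc n} c with c zero | ∑∣colourClass∣≡n (λ v → c (suc v))
... | zero | sum≡n = cong suc sum≡n
... | suc zero | sum≡n = trans (cong (_+ c₂) (+-suc c₀ c₁)) (cong suc sum≡n)
  where
  c₀ = ∣ colourClass (λ v → c (suc v)) zero ∣
  c₁ = ∣ colourClass (λ v → c (suc v)) (suc zero) ∣
  c₂ = ∣ colourClass (λ v → c (suc v)) (suc (suc zero)) ∣
... | suc (suc zero) | sum≡n = trans (+-suc _ _) (cong suc sum≡n)

pigeonhole : ∀ k (c : Fin n → Fin 3) → n < 3 * suc k → ∃[ i ] ∣ colourClass c i ∣ ≤ k
pigeonhole k c n<3[1+k]
  with ∣ colourClass c zero ∣ ≤? k
     | ∣ colourClass c (suc zero) ∣ ≤? k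
     | ∣ colourClass c (suc (suc zero)) ∣ ≤? k
... | yes c₀≤k | _ | _ = zero , c₀≤k
... | no _ | yes c₁≤k | _ = suc zero , c₁≤k
... | no _ | no _ | yes c₂≤k = suc (suc zero) , c₂≤k
... | no c₀≰k | no c₁≰k | no c₂≰k = ⊥-elim (<⇒≱ n<3[1+k] (begin
  3 * suc k                      ≡⟨ cong (λ m → suc k + (suc k + m)) (+-identityʳ (suc k)) ⟩
  suc k + (suc k + suc k)        ≡⟨ +-assoc (suc k) (suc k) (suc k) ⟨
  suc k + suc k + suc k          ≤⟨ +-mono-≤ (+-mono-≤ (≰⇒> c₀≰k) (≰⇒> c₁≰k)) (≰⇒> c₂≰k) ⟩
  ∣ colourClass c zero ∣ + ∣ colourClass c (suc zero) ∣ + ∣ colourClass c (suc (suc zero)) ∣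
                                 ≡⟨ ∑∣colourClass∣≡n c ⟩
  _                              ∎))
  where open ≤-Reasoning

ProperTwoColoring-lookup : (F : Subset n → Set) (r : Subset n) →
  (∀ f → F f → ¬ Empty (f ∩ r)) → (∀ f → F f → ¬ Empty (f ∩ ∁ r)) →
  ProperTwoColoring F (lookup r)
ProperTwoColoring-lookup F r meets-r meets-∁r f Ff
  with nonempty? (f ∩ r) | nonempty? (f ∩ ∁ r)
... | no empty | _ = ⊥-elim (meets-r f Ff empty)
... | yes _ | no empty = ⊥-elim (meets-∁r f Ff empty)
... | yes (u , u∈f∩r) | yes (w , w∈f∩∁r) =
  let u∈f , u∈r = x∈p∩q⁻ f r u∈f∩r
      w∈f , w∈∁r = x∈p∩q⁻ f (∁ r) w∈f∩∁r
  in u , w , u∈f , w∈f , []=⇒lookup u∈r , w∉r⇒lookup≡false (x∈∁p⇒x∉p w∈∁r)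
  where
  w∉r⇒lookup≡false : w ∉ r → lookup r w ≡ false
  w∉r⇒lookup≡false w∉r with lookup r w in eq
  ... | true = ⊥-elim (w∉r (lookup⇒[]= w r eq))
  ... | false = refl

Empty[∁q∩r∩p]⇒p⊆q : p ⊆ r → Empty ((∁ q ∩ r) ∩ p) → p ⊆ q
Empty[∁q∩r∩p]⇒p⊆q p⊆r empty {x} x∈p =
  x∉∁p⇒x∈p (λ x∈∁q → empty (x , x∈p∩q⁺ (x∈p∩q⁺ (x∈∁q , p⊆r x∈p) , x∈p)))

K1⇒avoidingEdge : ∀ k {K : Family n} → k ≤ n → K1 (suc k) K →
  ∀ s → ∣ s ∣ ≤ k → ∃[ e ] (EdgeH (suc k) K e × Empty (e ∩ s))
K1⇒avoidingEdge k k≤n k1 s ∣s∣≤k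
  with a , s⊆a , _ , ∣a∣≡k ← ∃-⊆-⊆-∣∣≡ s ⊤ ⊆⊤ k ∣s∣≤k (subst (k ≤_) (sym (∣⊤∣≡n _)) k≤n)
  with v , v∉a , K[a∪v]≡false ← k1 a ∣a∣≡k =
  ∁ (a ∪ ⁅ v ⁆) ,
  (a ∪ ⁅ v ⁆ , (trans (x∉p⇒∣p∪⁅x⁆∣≡1+∣p∣ a v v∉a) (cong suc ∣a∣≡k) , K[a∪v]≡false) , refl) ,
  λ (x , x∈e∩s) → let x∈e , x∈s = x∈p∩q⁻ (∁ (a ∪ ⁅ v ⁆)) s x∈e∩s in
    x∈∁p⇒x∉p x∈e (p⊆p∪q ⁅ v ⁆ (s⊆a x∈s))

HeavyRestrictedEdges⇒⊆×≤ : ∀ {h} {E : Subset n → Set} {X} {F} → HeavyRestrictedEdges h E X F →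
  ∀ f → F f → f ⊆ X × h ≤ ∣ f ∣
HeavyRestrictedEdges⇒⊆×≤ heavy f Ff with (_ , _ , refl) , h≤∣f∣ ← heavy f Ff =
  p∩q⊆q _ _ , h≤∣f∣

module _ {h : ℕ} {K : Family n} (K⊆[V,h] : FamilyOfHSets h K) where

  ⊆-InG⇒K≢true : InG h K q → p ⊆ q → K p ≢ true
  ⊆-InG⇒K≢true {q = q} {p} (∣q∣≡h , Kq≡false) p⊆q Kp≡true
    with refl ← p⊆q∧∣q∣≤∣p∣⇒p≡q p⊆q (≤-reflexive (trans ∣q∣≡h (sym (K⊆[V,h] p Kp≡true))))
    with () ← trans (sym Kp≡true) Kq≡false

  K2⇒twoColourable : K2 h K → ∀ X → 2 * h ≤ ∣ X ∣ →
    ∀ F → HeavyRestrictedEdges h (EdgeH h K) X F → ∃[ c ] ProperTwoColoring F c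
  K2⇒twoColourable k2 X 2h≤∣X∣ F heavy
    with X′ , X′⊆X , ∣X′∣≡2h ← ∃-⊆-∣∣≡ X (2 * h) 2h≤∣X∣
    with R , R⊆X′ , _ , KR≡true , K[X′─R]≡true ← k2 X′ ∣X′∣≡2h =
    lookup R , ProperTwoColoring-lookup F R meets-R meets-∁R
    where
    meets-R : ∀ f → F f → ¬ Empty (f ∩ R)
    meets-R f Ff empty with (_ , (B , B∈𝒢 , refl) , refl) , _ ← heavy f Ff =
      ⊆-InG⇒K≢true B∈𝒢 (Empty[∁q∩r∩p]⇒p⊆q (⊆-trans R⊆X′ X′⊆X) empty) KR≡true
    meets-∁R : ∀ f → F f → ¬ Empty (f ∩ ∁ R)
    meets-∁R f Ff empty with (_ , (B , B∈𝒢 , refl) , refl) , _ ← heavy f Ff =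
      ⊆-InG⇒K≢true B∈𝒢 (Empty[∁q∩r∩p]⇒p⊆q (⊆-trans (p─q⊆p X′ R) X′⊆X) empty′) K[X′─R]≡true
      where
      empty′ : Empty ((∁ B ∩ X) ∩ (X′ ─ R))
      empty′ (x , x∈f∩[X′─R]) =
        let x∈f , x∈X′─R = x∈p∩q⁻ (∁ B ∩ X) (X′ ─ R) x∈f∩[X′─R]
        in empty (x , x∈p∩q⁺ (x∈f , x∉p⇒x∈∁p (x∈p─q⇒x∉q X′ R x∈X′─R)))

  K3⇒twoColourable : .{{NonZero h}} → K3 h K → ∀ X → ∣ ∁ X ∣ ≡ h → ∣ X ∣ < 2 * h →
    ∀ F → HeavyRestrictedEdges h (EdgeH h K) X F → ∃[ c ] ProperTwoColoring F c
  K3⇒twoColourable k3 X ∣∁X∣≡h ∣X∣<2h F heavy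
    with U , U⊆∁∁X , ∣U∣≡h∸1 , K[U∪y]≡true ← k3 (∁ X) ∣∁X∣≡h =
    lookup U , ProperTwoColoring-lookup F U meets-U meets-∁U
    where
    U⊆X : U ⊆ X
    U⊆X x∈U = x∉∁p⇒x∈p (x∈∁p⇒x∉p (U⊆∁∁X x∈U))
    meets-∁U : ∀ f → F f → ¬ Empty (f ∩ ∁ U)
    meets-∁U f Ff =
      ∣q∣<∣p∣⇒¬Empty[p∩∁q] (<-≤-trans ∣U∣<h (proj₂ (HeavyRestrictedEdges⇒⊆×≤ heavy f Ff)))
      where
      ∣U∣<h : ∣ U ∣ < h
      ∣U∣<h = subst (_< h) (sym ∣U∣≡h∸1) (m≤pred[n]⇒suc[m]≤n ≤-refl)
    meets-U : ∀ f → F f → ¬ Empty (f ∩ U)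
    meets-U f Ff empty with (_ , (B , B∈𝒢@(∣B∣≡h , _) , refl) , refl) , h≤∣f∣ ← heavy f Ff
      with nonempty? (B ∩ ∁ X)
    ... | yes (y , y∈B∩∁X) = ⊆-InG⇒K≢true B∈𝒢 U∪y⊆B (K[U∪y]≡true y y∈∁X)
      where
      y∈∁X : y ∈ ∁ X
      y∈∁X = proj₂ (x∈p∩q⁻ B (∁ X) y∈B∩∁X)
      U∪y⊆B : U ∪ ⁅ y ⁆ ⊆ B
      U∪y⊆B x∈U∪y with x∈p∪q⁻ U ⁅ y ⁆ x∈U∪y
      ... | inj₁ x∈U = Empty[∁q∩r∩p]⇒p⊆q U⊆X empty x∈U
      ... | inj₂ x∈⁅y⁆ rewrite x∈⁅y⁆⇒x≡y y x∈⁅y⁆ = proj₁ (x∈p∩q⁻ B (∁ X) y∈B∩∁X)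
    ... | no B∩∁X-empty = <⇒≱ ∣X∣<2h (begin
      2 * h                 ≡⟨ cong (h +_) (+-identityʳ h) ⟩
      h + h                 ≤⟨ +-mono-≤ (≤-reflexive (sym ∣B∣≡h)) h≤∣f∣ ⟩
      ∣ B ∣ + ∣ ∁ B ∩ X ∣   ≤⟨ Empty[p∩q]⇒∣p∣+∣q∣≤∣r∣ B∩f-empty
                                 (Empty[p∩∁q]⇒p⊆q B∩∁X-empty) (p∩q⊆q (∁ B) X) ⟩
      ∣ X ∣                 ∎)
      where
      open ≤-Reasoning
      B∩f-empty : Empty (B ∩ (∁ B ∩ X))
      B∩f-empty (x , x∈B∩f) =
        let x∈B , x∈f = x∈p∩q⁻ B (∁ B ∩ X) x∈B∩f
        in x∈∁p⇒x∉p (proj₁ (x∈p∩q⁻ (∁ B) X x∈f)) x∈B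

small⇒twoColourable : ∀ {h} (X M : Subset n) → M ⊆ X → ∣ M ∣ < h → ∣ X ∣ < h + ∣ M ∣ →
  ∀ F → (∀ f → F f → f ⊆ X × h ≤ ∣ f ∣) → ∃[ c ] ProperTwoColoring F c
small⇒twoColourable {h = h} X M M⊆X ∣M∣<h ∣X∣<h+∣M∣ F edges =
  lookup M , ProperTwoColoring-lookup F M meets-M meets-∁M
  where
  meets-M : ∀ f → F f → ¬ Empty (f ∩ M)
  meets-M f Ff empty = <⇒≱ ∣X∣<h+∣M∣ (begin
    h + ∣ M ∣   ≤⟨ +-monoˡ-≤ ∣ M ∣ h≤∣f∣ ⟩
    ∣ f ∣ + ∣ M ∣ ≤⟨ Empty[p∩q]⇒∣p∣+∣q∣≤∣r∣ empty f⊆X M⊆X ⟩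
    ∣ X ∣       ∎)
    where
    open ≤-Reasoning
    f⊆X = proj₁ (edges f Ff)
    h≤∣f∣ = proj₂ (edges f Ff)
  meets-∁M : ∀ f → F f → ¬ Empty (f ∩ ∁ M)
  meets-∁M f Ff = ∣q∣<∣p∣⇒¬Empty[p∩∁q] (<-≤-trans ∣M∣<h (proj₂ (edges f Ff)))

K1⇒¬Polychromatic3 : ∀ k (K : Family (3 * suc k ∸ 1)) → K1 (suc k) K →
  ¬ (∃[ c ] Polychromatic3 (EdgeH (suc k) K) c)
K1⇒¬Polychromatic3 k K k1 (c , polychromatic)
  with i , ∣Cᵢ∣≤k ← pigeonhole k c (n<1+n _)
  with e , e∈ℋ , empty ← K1⇒avoidingEdge k (m≤m+n k _) k1 (colourClass c i) ∣Cᵢ∣≤k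
  with w , w∈e , cw≡i ← polychromatic e e∈ℋ i =
  empty (w , x∈p∩q⁺ (w∈e , subst (λ j → w ∈ colourClass c j) cw≡i (x∈colourClass[c[x]] c w)))

K2∧K3⇒twoColourable : ∀ k (K : Family (3 * suc k ∸ 1)) →
  FamilyOfHSets (suc k) K → K2 (suc k) K → K3 (suc k) K →
  ∀ X F → HeavyRestrictedEdges (suc k) (EdgeH (suc k) K) X F → ∃[ c ] ProperTwoColoring F c
K2∧K3⇒twoColourable k K K⊆[V,h] k2 k3 X F heavy
  with 2 * suc k ≤? ∣ X ∣ | k + suc k ≤? ∣ X ∣ | k ≤? ∣ X ∣
... | yes 2h≤∣X∣ | _ | _ = K2⇒twoColourable K⊆[V,h] k2 X 2h≤∣X∣ F heavy
... | no 2h≰∣X∣ | yes 2h-1≤∣X∣ | _ =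
  K3⇒twoColourable K⊆[V,h] k3 X ∣∁X∣≡h (≰⇒> 2h≰∣X∣) F heavy
  where
  open ≡-Reasoning
  ∣X∣≡2h-1 : ∣ X ∣ ≡ k + suc k
  ∣X∣≡2h-1 = ≤-antisym
    (subst (∣ X ∣ ≤_) (cong (k +_) (+-identityʳ (suc k))) (≤-pred (≰⇒> 2h≰∣X∣))) 2h-1≤∣X∣
  ∣∁X∣≡h : ∣ ∁ X ∣ ≡ suc k
  ∣∁X∣≡h = begin
    ∣ ∁ X ∣                           ≡⟨ ∣∁p∣≡n∸∣p∣ X ⟩
    k + (suc k + (suc k + 0)) ∸ ∣ X ∣ ≡⟨ cong₂ _∸_ (cong (λ m → k + (suc k + m)) (+-identityʳ (suc k)))
                                                  ∣X∣≡2h-1 ⟩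
    k + (suc k + suc k) ∸ (k + suc k) ≡⟨ cong (_∸ (k + suc k)) (+-assoc k (suc k) (suc k)) ⟨
    k + suc k + suc k ∸ (k + suc k)   ≡⟨ m+n∸m≡n (k + suc k) (suc k) ⟩
    suc k                             ∎
... | no _ | no 2h-1≰∣X∣ | yes h-1≤∣X∣
  with M , M⊆X , ∣M∣≡k ← ∃-⊆-∣∣≡ X k h-1≤∣X∣ =
  small⇒twoColourable X M M⊆X (≤-reflexive (cong suc ∣M∣≡k))
    (subst (λ m → ∣ X ∣ < suc k + m) (sym ∣M∣≡k)
      (≤-trans (≰⇒> 2h-1≰∣X∣) (≤-reflexive (+-comm k (suc k)))))
    F (HeavyRestrictedEdges⇒⊆×≤ heavy)
... | no _ | no _ | no h-1≰∣X∣ =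
  small⇒twoColourable X X ⊆-refl (m≤n⇒m≤1+n (≰⇒> h-1≰∣X∣)) (m<n+m ∣ X ∣ z<s)
    F (HeavyRestrictedEdges⇒⊆×≤ heavy)

lemma3 : (h : ℕ) → 2 ≤ h → (K : Family (3 * h ∸ 1)) →
    FamilyOfHSets h K → K1 h K → K2 h K → K3 h K →
    (¬ (∃[ c ] Polychromatic3 (EdgeH h K) c))
    × (∀ (X : Subset (3 * h ∸ 1)) (W : Subset (3 * h ∸ 1)) → W ⊆ X →
    (F : Subset (3 * h ∸ 1) → Set) →
    HeavyRestrictedEdges h (EdgeH h K) X F →
    (∀ f → F f → f ⊆ W) →
    ∃[ c ] ProperTwoColoring F c)
lemma3 (suc k) _ K K⊆[V,h] k1 k2 k3 =
  K1⇒¬Polychromatic3 k K k1 ,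
  λ X _ _ F heavy _ → K2∧K3⇒twoColourable k K K⊆[V,h] k2 k3 X F heavy
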